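{- Let $G$ be a finite simple graph on $[n]$ and let $v$ be an internal vertex of $G$. Then $\operatorname{iv}(G)>\operatorname{iv}(G_v)$ and $\operatorname{iv}(G)>\operatorname{iv}(G\setminus v)$.
   Context: A vertex of a graph is a free (simplicial) vertex if it belongs to exactly one maximal clique of the graph; it is an internal vertex if it is not free. $\operatorname{iv}(G)$ denotes the number of internal vertices of $G$. $N_G(v)=\{u:\{u,v\}\in E(G)\}$. $G_v$ is the graph on $V(G)$ with edge set $E(G)\cup\{\{u,w\}: u,w\in N_G(v), u\neq w\}$. $G\setminus v$ is the induced subgraph of $G$ on $V(G)\setminus\{v\}$. -}

module Defs where

open import Data.Nat using (ℕ; zero; suc)
open import Data.Bool using (Bool; true; false; _∧_; _∨_; not; T?)
open import Data.Bool.Properties using (∧-comm; ∨-zeroʳ)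
open import Data.Nat.Properties using () renaming (_≟_ to _ℕ≟_)
open import Data.Fin using (Fin; zero; suc; punchIn; _≟_)
open import Data.Vec using (Vec; []; _∷_; lookup)
open import Data.List using (List; []; _∷_; _++_; map; filter; length; allFin)
open import Data.Bool.ListAction using (all; any)
open import Relation.Nullary.Decidable using (⌊_⌋)
open import Relation.Binary.PropositionalEquality using (_≡_; refl; cong; cong₂)
open import Data.Product using (_×_)
import Data.Empty
import Relation.Nullary

record Graph (n : ℕ) : Set where
  field
    adj    : Fin n → Fin n → Bool
    sym    : ∀ u w → adj u w ≡ adj w u
    irrefl : ∀ u → adj u u ≡ false
open Graph public

_==_ : ∀ {n} → Fin n → Fin n → Bool
u == w = ⌊ u ≟ w ⌋

Subset : ℕ → Set
Subset n = Vec Bool n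

allSubsets : (n : ℕ) → List (Subset n)
allSubsets zero    = [] ∷ []
allSubsets (suc n) = map (false ∷_) (allSubsets n) ++ map (true ∷_) (allSubsets n)

_∈ˢ_ : ∀ {n} → Fin n → Subset n → Bool
x ∈ˢ S = lookup S x

isClique : ∀ {n} → Graph n → Subset n → Bool
isClique {n} G S =
  all (λ u → all (λ w → not (u ∈ˢ S ∧ w ∈ˢ S ∧ not (u == w)) ∨ adj G u w) (allFin n)) (allFin n)

_⊆ˢ_ : ∀ {n} → Subset n → Subset n → Bool
_⊆ˢ_ {n} S T = all (λ x → not (x ∈ˢ S) ∨ x ∈ˢ T) (allFin n)

_⊂ˢ_ : ∀ {n} → Subset n → Subset n → Bool
S ⊂ˢ T = (S ⊆ˢ T) ∧ not (T ⊆ˢ S)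

isMaximalClique : ∀ {n} → Graph n → Subset n → Bool
isMaximalClique {n} G S =
  isClique G S ∧ not (any (λ T → isClique G T ∧ (S ⊂ˢ T)) (allSubsets n))

maxCliquesContaining : ∀ {n} → Graph n → Fin n → List (Subset n)
maxCliquesContaining {n} G v =
  filter (λ S → T? (isMaximalClique G S ∧ v ∈ˢ S)) (allSubsets n)

isFree : ∀ {n} → Graph n → Fin n → Bool
isFree G v = ⌊ length (maxCliquesContaining G v) ℕ≟ 1 ⌋

IsInternal : ∀ {n} → Graph n → Fin n → Set
IsInternal G v = isFree G v ≡ false

iv : ∀ {n} → Graph n → ℕ
iv {n} G = length (filter (λ v → T? (not (isFree G v))) (allFin n))

completeNbhd : ∀ {n} → Graph n → Fin n → Graph n
completeNbhd G v = record
  { adj    = λ u w → adj G u w ∨ (adj G v u ∧ adj G v w ∧ not (u == w))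
  ; sym    = λ u w → cong₂ _∨_ (Graph.sym G u w) (symPart u w)
  ; irrefl = λ u → irr u
  }
  where
    ==-sym : ∀ u w → (u == w) ≡ (w == u)
    ==-sym u w with u ≟ w | w ≟ u
    ... | Relation.Nullary.yes _ | Relation.Nullary.yes _ = refl
    ... | Relation.Nullary.no _  | Relation.Nullary.no _  = refl
    ... | Relation.Nullary.yes refl | Relation.Nullary.no ¬p = Data.Empty.⊥-elim (¬p refl)
    ... | Relation.Nullary.no ¬p | Relation.Nullary.yes refl = Data.Empty.⊥-elim (¬p refl)
    ==-refl : ∀ u → (u == u) ≡ true
    ==-refl u with u ≟ u
    ... | Relation.Nullary.yes _ = refl
    ... | Relation.Nullary.no ¬p = Data.Empty.⊥-elim (¬p refl)
    symPart : ∀ u w → (adj G v u ∧ adj G v w ∧ not (u == w)) ≡ (adj G v w ∧ adj G v u ∧ not (w == u))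
    symPart u w with adj G v u | adj G v w
    ... | false | false = refl
    ... | false | true  = refl
    ... | true  | false = refl
    ... | true  | true  = cong not (==-sym u w)
    irr : ∀ u → (adj G u u ∨ (adj G v u ∧ adj G v u ∧ not (u == u))) ≡ false
    irr u rewrite Graph.irrefl G u | ==-refl u = ∨-zeroʳ' (adj G v u)
      where
        ∨-zeroʳ' : ∀ b → (b ∧ b ∧ not true) ≡ false
        ∨-zeroʳ' false = refl
        ∨-zeroʳ' true  = refl

deleteVertex : ∀ {m} → Graph (suc m) → Fin (suc m) → Graph m
deleteVertex G v = record
  { adj    = λ i j → adj G (punchIn v i) (punchIn v j)
  ; sym    = λ i j → Graph.sym G (punchIn v i) (punchIn v j)
  ; irrefl = λ i → Graph.irrefl G (punchIn v i)
  }

-- A vertex v is free exactly when its neighbourhood is a clique: then the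
-- closed neighbourhood N[v] is the only maximal clique through v, while two
-- non-adjacent neighbours u, w would extend {v, u} and {v, w} to two different
-- maximal cliques through v. Completing N(v) and deleting v both keep every
-- neighbourhood that was a clique a clique, so the internal vertices of G_v
-- and of G \ v form a subset of those of G; and v, internal in G, becomes free
-- in G_v and is absent from G \ v.
module Submission where

open import Defs hiding (sym; irrefl)
open import Data.Bool using (Bool; true; false; T; not; _∧_; _∨_; T?)
open import Data.Bool.Properties using (T-≡; T-∧; T-∨; T-not-≡)
open import Data.Empty using (⊥-elim)
open import Data.Fin using (Fin; zero; suc; punchIn; _≟_)
open import Data.Fin.Properties using (punchIn-injective)
open import Data.Fin.Subset using (_⊆_; _⊂_; ∣_∣)
open import Data.Fin.Subset.Properties using (p⊆q⇒∣p∣≤∣q∣; p⊂q⇒∣p∣<∣q∣)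
open import Data.List using (List; []; _∷_; map; filter; length; allFin)
import Data.List as List
open import Data.List.Membership.Propositional using (_∈_; lose)
open import Data.List.Membership.Propositional.Properties using (∈-allFin; ∈-filter⁺; ∈-filter⁻; ∈-map⁺; ∈-map⁻; ∈-++⁺ˡ; ∈-++⁺ʳ)
open import Data.Bool.ListAction using (all; any)
import Data.List.Relation.Unary.All as All
open import Data.List.Relation.Unary.All.Properties using (all⁺; all⁻)
open import Data.List.Relation.Unary.Any using (here; there; satisfied)
open import Data.List.Relation.Unary.Any.Properties using (any⁺; any⁻)
open import Data.List.Relation.Unary.AllPairs using ([]; _∷_)
open import Data.List.Relation.Unary.Unique.Propositional using (Unique)
import Data.List.Relation.Unary.Unique.Propositional.Properties as Unique
open import Data.Nat using (ℕ; zero; suc; _<_; _>_; s≤s)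
open import Data.Nat.Properties using (n<1+n; module ≤-Reasoning)
open import Data.Product using (Σ-syntax; _×_; _,_; proj₁; proj₂)
open import Data.Sum using (_⊎_; inj₁; inj₂)
open import Data.Unit using (tt)
open import Data.Vec using ([]; _∷_; lookup; tabulate; removeAt; _[_]=_)
open import Data.Vec.Properties using (lookup∘tabulate; tabulate∘lookup; tabulate-cong; lookup⇒[]=; []=⇒lookup; ∷-injectiveʳ)
open import Function using (_∘_; id; _⇔_; mk⇔; Equivalence)
open import Relation.Binary.PropositionalEquality using (_≡_; _≢_; refl; sym; trans; cong; subst; module ≡-Reasoning)
open import Relation.Nullary using (¬_; Dec; yes; no)
open import Relation.Nullary.Decidable using (map′; toWitness; fromWitness; toWitnessFalse; fromWitnessFalse)

open Equivalence using (to; from)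

private
  variable
    m n : ℕ
    A : Set

T-not : ∀ {b} → T (not b) ⇔ (¬ T b)
T-not {false} = mk⇔ (λ _ ()) (λ _ → tt)
T-not {true}  = mk⇔ (λ ()) (λ ¬t → ¬t tt)

T-not-∨ : ∀ {a b} → T (not a ∨ b) ⇔ (T a → T b)
T-not-∨ {false} = mk⇔ (λ _ ()) (λ _ → tt)
T-not-∨ {true}  = mk⇔ (λ t _ → t) (λ f → f tt)

T-antisym : ∀ {a b} → (T a → T b) → (T b → T a) → a ≡ b
T-antisym {false} {false} _   _   = refl
T-antisym {false} {true}  _   b⇒a = ⊥-elim (b⇒a tt)
T-antisym {true}  {false} a⇒b _   = ⊥-elim (a⇒b tt)
T-antisym {true}  {true}  _   _   = refl

T-== : {u w : Fin n} → T (u == w) ⇔ (u ≡ w)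
T-== = mk⇔ toWitness fromWitness

T-all-allFin : ∀ {m} (p : Fin m → Bool) → T (all p (allFin m)) ⇔ (∀ x → T (p x))
T-all-allFin {m} p = mk⇔ (λ h x → All.lookup (all⁺ p (allFin m) h) (∈-allFin x))
                        (λ h → all⁻ p {allFin m} (All.tabulate λ {x} _ → h x))

-- Vertex sets are characteristic functions; a Subset M of Defs is read as lookup M.

infix 4 _⊆ᶠ_
_⊆ᶠ_ : (Fin n → Bool) → (Fin n → Bool) → Set
S ⊆ᶠ S′ = ∀ {x} → T (S x) → T (S′ x)

lookup∘tabulate-⊆ᶠ : (S : Fin n → Bool) → lookup (tabulate S) ⊆ᶠ S
lookup∘tabulate-⊆ᶠ S {x} = subst T (lookup∘tabulate S x)

⊆ᶠ-lookup∘tabulate : (S : Fin n → Bool) → S ⊆ᶠ lookup (tabulate S)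
⊆ᶠ-lookup∘tabulate S {x} = subst T (sym (lookup∘tabulate S x))

⊆ᶠ-antisym : (M M′ : Subset n) → lookup M ⊆ᶠ lookup M′ → lookup M′ ⊆ᶠ lookup M → M ≡ M′
⊆ᶠ-antisym M M′ M⊆M′ M′⊆M = begin
  M                    ≡⟨ tabulate∘lookup M ⟨
  tabulate (lookup M)  ≡⟨ tabulate-cong (λ x → T-antisym M⊆M′ M′⊆M) ⟩
  tabulate (lookup M′) ≡⟨ tabulate∘lookup M′ ⟩
  M′                   ∎
  where open ≡-Reasoning

insert : Fin n → (Fin n → Bool) → Fin n → Bool
insert x S y = (y == x) ∨ S y

insert⁻ : (x : Fin n) (S : Fin n → Bool) {y : Fin n} → T (insert x S y) → y ≡ x ⊎ T (S y)
insert⁻ x S h with to T-∨ h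
... | inj₁ y≡x = inj₁ (toWitness y≡x)
... | inj₂ y∈S = inj₂ y∈S

x∈insert : (x : Fin n) (S : Fin n → Bool) → T (insert x S x)
x∈insert x S = from T-∨ (inj₁ (fromWitness {a? = x ≟ x} refl))

⊆-insert : (x : Fin n) (S : Fin n → Bool) → S ⊆ᶠ insert x S
⊆-insert x S y∈S = from T-∨ (inj₂ y∈S)

insert-⊆ : (x : Fin n) {S S′ : Fin n → Bool} → S ⊆ᶠ S′ → T (S′ x) → insert x S ⊆ᶠ S′
insert-⊆ x {S} S⊆S′ x∈S′ h with insert⁻ x S h
... | inj₁ refl = x∈S′
... | inj₂ y∈S  = S⊆S′ y∈S

∈-allSubsets : (S : Subset n) → S ∈ allSubsets n
∈-allSubsets []                  = here refl
∈-allSubsets {suc n} (false ∷ S) = ∈-++⁺ˡ (∈-map⁺ (false ∷_) (∈-allSubsets S))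
∈-allSubsets {suc n} (true ∷ S)  = ∈-++⁺ʳ (map (false ∷_) (allSubsets n)) (∈-map⁺ (true ∷_) (∈-allSubsets S))

unique-allSubsets : ∀ n → Unique (allSubsets n)
unique-allSubsets zero    = All.[] ∷ []
unique-allSubsets (suc n) = Unique.++⁺ (Unique.map⁺ ∷-injectiveʳ (unique-allSubsets n))
  (Unique.map⁺ ∷-injectiveʳ (unique-allSubsets n)) differentHeads
  where
    differentHeads : ∀ {S} → ¬ (S ∈ map (false ∷_) (allSubsets n) × S ∈ map (true ∷_) (allSubsets n))
    differentHeads (S∈₀ , S∈₁) with ∈-map⁻ (false ∷_) S∈₀ | ∈-map⁻ (true ∷_) S∈₁
    ... | _ , _ , refl | _ , _ , ()

Unique⇒length≡1 : {xs : List A} {x : A} → Unique xs → x ∈ xs → (∀ {y} → y ∈ xs → y ≡ x) → length xs ≡ 1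
Unique⇒length≡1 {xs = _ ∷ []}    _                   _ _     = refl
Unique⇒length≡1 {xs = _ ∷ _ ∷ _} ((y≢z All.∷ _) ∷ _) _ all≡x =
  ⊥-elim (y≢z (trans (all≡x (here refl)) (sym (all≡x (there (here refl))))))

length≡1⇒∈-unique : {xs : List A} {x y : A} → length xs ≡ 1 → x ∈ xs → y ∈ xs → x ≡ y
length≡1⇒∈-unique {xs = _ ∷ []} _ (here refl) (here refl) = refl

isInternal : Graph n → Fin n → Bool
isInternal G x = not (isFree G x)

module _ (G : Graph n) where

  IsClique : (Fin n → Bool) → Set
  IsClique S = ∀ {u w} → T (S u) → T (S w) → u ≢ w → T (adj G u w)

  IsMaximalClique : Subset n → Set
  IsMaximalClique M = IsClique (lookup M) × (∀ {S} → IsClique S → lookup M ⊆ᶠ S → S ⊆ᶠ lookup M)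

  adj-sym : ∀ {u w} → T (adj G u w) → T (adj G w u)
  adj-sym {u} {w} = subst T (Graph.sym G u w)

  clique-⊆ : {S S′ : Fin n → Bool} → S ⊆ᶠ S′ → IsClique S′ → IsClique S
  clique-⊆ S⊆S′ c u∈S w∈S = c (S⊆S′ u∈S) (S⊆S′ w∈S)

  insert-clique : (x : Fin n) {S : Fin n → Bool} →
    IsClique S → (∀ {y} → T (S y) → y ≢ x → T (adj G x y)) → IsClique (insert x S)
  insert-clique x {S} c x~S u∈ w∈ u≢w with insert⁻ x S u∈ | insert⁻ x S w∈
  ... | inj₁ refl | inj₁ refl = ⊥-elim (u≢w refl)
  ... | inj₁ refl | inj₂ w∈S  = x~S w∈S (u≢w ∘ sym)
  ... | inj₂ u∈S  | inj₁ refl = adj-sym (x~S u∈S u≢w)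
  ... | inj₂ u∈S  | inj₂ w∈S  = c u∈S w∈S u≢w

  isClique⇔IsClique : (S : Subset n) → T (isClique G S) ⇔ IsClique (lookup S)
  isClique⇔IsClique S = mk⇔
    (λ h {u} {w} → to (entry u w) (to (T-all-allFin _) (to (T-all-allFin _) h u) w))
    (λ c → from (T-all-allFin _) λ u → from (T-all-allFin _) λ w → from (entry u w) c)
    where
      entry : ∀ u w → T (not (u ∈ˢ S ∧ w ∈ˢ S ∧ not (u == w)) ∨ adj G u w)
                    ⇔ (T (u ∈ˢ S) → T (w ∈ˢ S) → u ≢ w → T (adj G u w))
      entry u w = mk⇔
        (λ h u∈ w∈ u≢w → to T-not-∨ h (from T-∧ (u∈ , from T-∧ (w∈ , fromWitnessFalse u≢w))))
        (λ f → from T-not-∨ λ h → let u∈ , h′ = to T-∧ h ; w∈ , u≢w = to T-∧ h′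
                                  in f u∈ w∈ (toWitnessFalse u≢w))

  ⊆ˢ⇔⊆ᶠ : (S S′ : Subset n) → T (S ⊆ˢ S′) ⇔ lookup S ⊆ᶠ lookup S′
  ⊆ˢ⇔⊆ᶠ S S′ = mk⇔ (λ h {x} → to T-not-∨ (to (T-all-allFin _) h x))
                    (λ f → from (T-all-allFin _) λ x → from T-not-∨ (f {x}))

  clique⇒isClique-tabulate : ∀ {S} → IsClique S → T (isClique G (tabulate S))
  clique⇒isClique-tabulate {S} c = from (isClique⇔IsClique (tabulate S)) (clique-⊆ (lookup∘tabulate-⊆ᶠ S) c)

  isClique? : (S : Fin n → Bool) → Dec (IsClique S)
  isClique? S = map′ (clique-⊆ (⊆ᶠ-lookup∘tabulate S) ∘ to (isClique⇔IsClique (tabulate S)))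
                     clique⇒isClique-tabulate
                     (T? (isClique G (tabulate S)))

  isMaximalClique⇔IsMaximalClique : (M : Subset n) → T (isMaximalClique G M) ⇔ IsMaximalClique M
  isMaximalClique⇔IsMaximalClique M = mk⇔ to′ from′
    where
      to′ : T (isMaximalClique G M) → IsMaximalClique M
      to′ h = to (isClique⇔IsClique M) (proj₁ (to T-∧ h)) , maximal
        where
          noLarger = to T-not (proj₂ (to T-∧ h))
          maximal : ∀ {S} → IsClique S → lookup M ⊆ᶠ S → S ⊆ᶠ lookup M
          maximal {S} c M⊆S with T? (tabulate S ⊆ˢ M)
          ... | yes S⊆M = λ x∈S → to (⊆ˢ⇔⊆ᶠ (tabulate S) M) S⊆M (⊆ᶠ-lookup∘tabulate S x∈S)
          ... | no S⊈M = ⊥-elim (noLarger (any⁺ _ (lose (∈-allSubsets (tabulate S))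
                  (from T-∧ (clique⇒isClique-tabulate c , from T-∧ (M⊆ˢS , from T-not S⊈M))))))
            where
              M⊆ˢS = from (⊆ˢ⇔⊆ᶠ M (tabulate S)) (λ x∈M → ⊆ᶠ-lookup∘tabulate S (M⊆S x∈M))

      from′ : IsMaximalClique M → T (isMaximalClique G M)
      from′ (c , maximal) = from T-∧ (from (isClique⇔IsClique M) c , from T-not noLarger)
        where
          noLarger : ¬ T (any (λ S → isClique G S ∧ (M ⊂ˢ S)) (allSubsets n))
          noLarger h with satisfied (any⁻ _ (allSubsets n) h)
          ... | S , larger with to T-∧ larger
          ... | S-clique , M⊂S with to T-∧ M⊂S
          ... | M⊆S , S⊈M = to T-not S⊈M (from (⊆ˢ⇔⊆ᶠ S M)
                  (maximal (to (isClique⇔IsClique S) S-clique) (to (⊆ˢ⇔⊆ᶠ M S) M⊆S)))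

  greedy : (Fin n → Bool) → List (Fin n) → Fin n → Bool
  greedy S []       = S
  greedy S (x ∷ xs) with isClique? (insert x S)
  ... | yes _ = greedy (insert x S) xs
  ... | no _  = greedy S xs

  greedy-clique : ∀ {S} xs → IsClique S → IsClique (greedy S xs)
  greedy-clique         []       c = c
  greedy-clique {S = S} (x ∷ xs) c with isClique? (insert x S)
  ... | yes c′ = greedy-clique xs c′
  ... | no _   = greedy-clique xs c

  ⊆-greedy : ∀ {S} xs → S ⊆ᶠ greedy S xs
  ⊆-greedy         []       y∈S = y∈S
  ⊆-greedy {S = S} (x ∷ xs) y∈S with isClique? (insert x S)
  ... | yes _ = ⊆-greedy xs (⊆-insert x S y∈S)
  ... | no _  = ⊆-greedy xs y∈S

  greedy-saturated : ∀ {S} xs {x} → x ∈ xs → IsClique (insert x (greedy S xs)) → T (greedy S xs x)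
  greedy-saturated {S = S} (x ∷ xs) (here refl) c with isClique? (insert x S)
  ... | yes _  = ⊆-greedy xs (x∈insert x S)
  ... | no ¬c′ = ⊥-elim (¬c′ (clique-⊆ S+x⊆greedy+x c))
    where
      S+x⊆greedy+x : insert x S ⊆ᶠ insert x (greedy S xs)
      S+x⊆greedy+x = insert-⊆ x (λ y∈S → ⊆-insert x (greedy S xs) (⊆-greedy xs y∈S))
                                (x∈insert x (greedy S xs))
  greedy-saturated {S = S} (y ∷ xs) (there x∈xs) c with isClique? (insert y S)
  ... | yes _ = greedy-saturated xs x∈xs c
  ... | no _  = greedy-saturated xs x∈xs c

  extendToMaximalClique : ∀ {S} → IsClique S → Σ[ M ∈ Subset n ] IsMaximalClique M × S ⊆ᶠ lookup M
  extendToMaximalClique {S} c =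
    tabulate M , (M-clique , maximal) , λ x∈S → ⊆ᶠ-lookup∘tabulate M (⊆-greedy (allFin n) x∈S)
    where
      M = greedy S (allFin n)
      M-clique : IsClique (lookup (tabulate M))
      M-clique = clique-⊆ (lookup∘tabulate-⊆ᶠ M) (greedy-clique (allFin n) c)
      maximal : ∀ {S′} → IsClique S′ → lookup (tabulate M) ⊆ᶠ S′ → S′ ⊆ᶠ lookup (tabulate M)
      maximal c′ M⊆S′ {x} x∈S′ = ⊆ᶠ-lookup∘tabulate M (greedy-saturated (allFin n) (∈-allFin x)
        (clique-⊆ (insert-⊆ x (λ y∈M → M⊆S′ (⊆ᶠ-lookup∘tabulate M y∈M)) x∈S′) c′))

  IsSimplicial : Fin n → Set
  IsSimplicial v = IsClique (adj G v)

  module _ (v : Fin n) where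

    closedNbhd : Fin n → Bool
    closedNbhd = insert v (adj G v)

    clique∋v⊆closedNbhd : ∀ {S} → IsClique S → T (S v) → S ⊆ᶠ closedNbhd
    clique∋v⊆closedNbhd c v∈S {x} x∈S with v ≟ x
    ... | yes refl = x∈insert v (adj G v)
    ... | no v≢x   = ⊆-insert v (adj G v) (c v∈S x∈S v≢x)

    ∈-maxCliquesContaining⇔ : ∀ {M} → M ∈ maxCliquesContaining G v ⇔ (IsMaximalClique M × T (lookup M v))
    ∈-maxCliquesContaining⇔ {M} = mk⇔
      (λ M∈ → let max , v∈M = to T-∧ (proj₂ (∈-filter⁻ P? {xs = allSubsets n} M∈))
              in to (isMaximalClique⇔IsMaximalClique M) max , v∈M)
      (λ (max , v∈M) → ∈-filter⁺ P? (∈-allSubsets M)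
        (from T-∧ (from (isMaximalClique⇔IsMaximalClique M) max , v∈M)))
      where
        P? = λ S → T? (isMaximalClique G S ∧ v ∈ˢ S)

    simplicial⇒length≡1 : IsSimplicial v → length (maxCliquesContaining G v) ≡ 1
    simplicial⇒length≡1 s =
      Unique⇒length≡1 (Unique.filter⁺ _ (unique-allSubsets n))
        (from ∈-maxCliquesContaining⇔ (C-maximal , v∈C)) onlyC
      where
        C = tabulate closedNbhd
        C-clique : IsClique (lookup C)
        C-clique = clique-⊆ (lookup∘tabulate-⊆ᶠ closedNbhd) (insert-clique v s (λ v~y _ → v~y))
        v∈C : T (lookup C v)
        v∈C = ⊆ᶠ-lookup∘tabulate closedNbhd (x∈insert v (adj G v))
        clique∋v⊆C : ∀ {S} → IsClique S → T (S v) → S ⊆ᶠ lookup C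
        clique∋v⊆C c v∈S x∈S = ⊆ᶠ-lookup∘tabulate closedNbhd (clique∋v⊆closedNbhd c v∈S x∈S)
        C-maximal : IsMaximalClique C
        C-maximal = C-clique , λ c C⊆S → clique∋v⊆C c (C⊆S v∈C)
        onlyC : ∀ {M} → M ∈ maxCliquesContaining G v → M ≡ C
        onlyC {M} M∈ with to ∈-maxCliquesContaining⇔ M∈
        ... | (M-clique , M-maximal) , v∈M = ⊆ᶠ-antisym M C M⊆C (M-maximal C-clique M⊆C)
          where M⊆C = clique∋v⊆C M-clique v∈M

    edge-clique : ∀ {x} → T (adj G v x) → IsClique (insert v (_== x))
    edge-clique {x} v~x = insert-clique v single (λ y≡x _ → subst (T ∘ adj G v) (sym (to T-== y≡x)) v~x)
      where
        single : IsClique (_== x)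
        single u≡x w≡x u≢w = ⊥-elim (u≢w (trans (to T-== u≡x) (sym (to T-== w≡x))))

    maxClique-through-edge : ∀ {x} → T (adj G v x) →
      Σ[ M ∈ Subset n ] M ∈ maxCliquesContaining G v × T (lookup M x)
    maxClique-through-edge {x} v~x with extendToMaximalClique (edge-clique v~x)
    ... | M , M-maximal , edge⊆M =
      M , from ∈-maxCliquesContaining⇔ (M-maximal , edge⊆M (x∈insert v (_== x))) ,
      edge⊆M (⊆-insert v (_== x) (fromWitness {a? = x ≟ x} refl))

    length≡1⇒simplicial : length (maxCliquesContaining G v) ≡ 1 → IsSimplicial v
    length≡1⇒simplicial one {u} {w} v~u v~w u≢w with maxClique-through-edge v~u | maxClique-through-edge v~w
    ... | Mu , Mu∈ , u∈Mu | Mw , Mw∈ , w∈Mw =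
      proj₁ (proj₁ (to ∈-maxCliquesContaining⇔ Mu∈)) u∈Mu
        (subst (λ M → T (lookup M w)) (length≡1⇒∈-unique one Mw∈ Mu∈) w∈Mw) u≢w

    internal⇔¬simplicial : T (isInternal G v) ⇔ (¬ IsSimplicial v)
    internal⇔¬simplicial = mk⇔ internal⇒¬simplicial ¬simplicial⇒internal
      where
        internal⇒¬simplicial : T (isInternal G v) → ¬ IsSimplicial v
        internal⇒¬simplicial int s = toWitnessFalse int (simplicial⇒length≡1 s)
        ¬simplicial⇒internal : ¬ IsSimplicial v → T (isInternal G v)
        ¬simplicial⇒internal ¬s = fromWitnessFalse λ one → ¬s (length≡1⇒simplicial one)

internal-reflected : (G : Graph n) (H : Graph m) (x : Fin n) (y : Fin m) →
  (IsSimplicial G x → IsSimplicial H y) → T (isInternal H y) → T (isInternal G x)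
internal-reflected G H x y simplicial⇒ y-internal =
  from (internal⇔¬simplicial G x) (λ s → to (internal⇔¬simplicial H y) y-internal (simplicial⇒ s))

module _ (G : Graph n) (v : Fin n) where

  completeNbhd-⊇ : ∀ {a b} → T (adj G a b) → T (adj (completeNbhd G v) a b)
  completeNbhd-⊇ a~b = from T-∨ (inj₁ a~b)

  completeNbhd-adj⁻ : ∀ {a b} → T (adj (completeNbhd G v) a b) →
    T (adj G a b) ⊎ (T (adj G v a) × T (adj G v b))
  completeNbhd-adj⁻ {a} {b} h with to T-∨ h
  ... | inj₁ a~b = inj₁ a~b
  ... | inj₂ h′ with to (T-∧ {adj G v a}) h′
  ...   | v~a , h″ = inj₂ (v~a , proj₁ (to (T-∧ {adj G v b}) h″))

  closedNbhd-clique-completeNbhd : IsClique (completeNbhd G v) (closedNbhd G v)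
  closedNbhd-clique-completeNbhd = insert-clique (completeNbhd G v) v
    (λ v~a v~b a≢b → from T-∨ (inj₂ (from T-∧ (v~a , from T-∧ (v~b , fromWitnessFalse a≢b)))))
    (λ v~a _ → completeNbhd-⊇ v~a)

  completeNbhd-simplicial : IsSimplicial (completeNbhd G v) v
  completeNbhd-simplicial = clique-⊆ (completeNbhd G v) nbr⊆closedNbhd closedNbhd-clique-completeNbhd
    where
      nbr⊆closedNbhd : adj (completeNbhd G v) v ⊆ᶠ closedNbhd G v
      nbr⊆closedNbhd h with completeNbhd-adj⁻ h
      ... | inj₁ v~a       = ⊆-insert v (adj G v) v~a
      ... | inj₂ (_ , v~a) = ⊆-insert v (adj G v) v~a

  simplicial⇒simplicial-completeNbhd : ∀ {w} → IsSimplicial G w → IsSimplicial (completeNbhd G v) w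
  simplicial⇒simplicial-completeNbhd {w} s with T? (adj G v w)
  ... | no ¬v~w = clique-⊆ (completeNbhd G v) nbr⊆nbr (λ a∈ b∈ a≢b → completeNbhd-⊇ (s a∈ b∈ a≢b))
    where
      nbr⊆nbr : adj (completeNbhd G v) w ⊆ᶠ adj G w
      nbr⊆nbr h with completeNbhd-adj⁻ h
      ... | inj₁ w~a       = w~a
      ... | inj₂ (v~w , _) = ⊥-elim (¬v~w v~w)
  ... | yes v~w = clique-⊆ (completeNbhd G v) nbr⊆closedNbhd closedNbhd-clique-completeNbhd
    where
      nbr⊆closedNbhd : adj (completeNbhd G v) w ⊆ᶠ closedNbhd G v
      nbr⊆closedNbhd {a} h with completeNbhd-adj⁻ h | v ≟ a
      ... | inj₂ (_ , v~a) | _       = ⊆-insert v (adj G v) v~a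
      ... | inj₁ _         | yes refl = x∈insert v (adj G v)
      ... | inj₁ w~a       | no v≢a  = ⊆-insert v (adj G v) (s (adj-sym G v~w) w~a v≢a)

simplicial⇒simplicial-deleteVertex : (G : Graph (suc n)) (v : Fin (suc n)) {i : Fin n} →
  IsSimplicial G (punchIn v i) → IsSimplicial (deleteVertex G v) i
simplicial⇒simplicial-deleteVertex G v s {a} {b} i~a i~b a≢b = s i~a i~b (a≢b ∘ punchIn-injective v a b)

internal : Graph n → Subset n
internal G = tabulate (isInternal G)

length-filter-tabulate : (p : A → Bool) (f : Fin n → A) →
  length (filter (λ x → T? (p x)) (List.tabulate f)) ≡ ∣ tabulate (p ∘ f) ∣
length-filter-tabulate {n = zero}  p f = refl
length-filter-tabulate {n = suc n} p f with p (f zero)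
... | true  = cong suc (length-filter-tabulate p (f ∘ suc))
... | false = length-filter-tabulate p (f ∘ suc)

iv≡∣internal∣ : (G : Graph n) → iv G ≡ ∣ internal G ∣
iv≡∣internal∣ G = length-filter-tabulate (isInternal G) id

tabulate-[]=⁺ : (p : Fin n → Bool) {x : Fin n} → T (p x) → tabulate p [ x ]= true
tabulate-[]=⁺ p {x} x∈p = lookup⇒[]= x (tabulate p) (to T-≡ (⊆ᶠ-lookup∘tabulate p x∈p))

tabulate-[]=⁻ : (p : Fin n → Bool) {x : Fin n} → tabulate p [ x ]= true → T (p x)
tabulate-[]=⁻ p x∈p = lookup∘tabulate-⊆ᶠ p (from T-≡ ([]=⇒lookup x∈p))

tabulate-⊆ : {p q : Fin n → Bool} → p ⊆ᶠ q → tabulate p ⊆ tabulate q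
tabulate-⊆ {p = p} {q} p⊆q x∈p = tabulate-[]=⁺ q (p⊆q (tabulate-[]=⁻ p x∈p))

tabulate-⊂ : {p q : Fin n → Bool} (x : Fin n) → p ⊆ᶠ q → T (q x) → ¬ T (p x) → tabulate p ⊂ tabulate q
tabulate-⊂ {p = p} {q} x p⊆q x∈q x∉p =
  tabulate-⊆ p⊆q , x , tabulate-[]=⁺ q x∈q , λ x∈p → x∉p (tabulate-[]=⁻ p x∈p)

removeAt-tabulate : (f : Fin (suc n) → A) (i : Fin (suc n)) →
  removeAt (tabulate f) i ≡ tabulate (f ∘ punchIn i)
removeAt-tabulate              f zero    = refl
removeAt-tabulate {n = suc n} f (suc i) = cong (f zero ∷_) (removeAt-tabulate (f ∘ suc) i)

∣b∷p∣<∣b∷q∣ : ∀ b {p : Subset m} {q : Subset n} → ∣ p ∣ < ∣ q ∣ → ∣ b ∷ p ∣ < ∣ b ∷ q ∣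
∣b∷p∣<∣b∷q∣ true  p<q = s≤s p<q
∣b∷p∣<∣b∷q∣ false p<q = p<q

∣removeAt∣<∣p∣ : (p : Subset (suc n)) (x : Fin (suc n)) → T (lookup p x) → ∣ removeAt p x ∣ < ∣ p ∣
∣removeAt∣<∣p∣ (true ∷ p)         zero    _   = n<1+n ∣ p ∣
∣removeAt∣<∣p∣ (b ∷ p@(_ ∷ _)) (suc x) x∈p = ∣b∷p∣<∣b∷q∣ b {removeAt p x} {p} (∣removeAt∣<∣p∣ p x x∈p)

iv-completeNbhd<iv : (G : Graph n) (v : Fin n) → IsInternal G v → iv (completeNbhd G v) < iv G
iv-completeNbhd<iv G v v-internal = begin-strict
  iv Gv            ≡⟨ iv≡∣internal∣ Gv ⟩
  ∣ internal Gv ∣  <⟨ p⊂q⇒∣p∣<∣q∣ (tabulate-⊂ v internalGv⊆internalG (from T-not-≡ v-internal) v-free-in-Gv) ⟩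
  ∣ internal G ∣   ≡⟨ iv≡∣internal∣ G ⟨
  iv G             ∎
  where
    open ≤-Reasoning
    Gv = completeNbhd G v
    internalGv⊆internalG : isInternal Gv ⊆ᶠ isInternal G
    internalGv⊆internalG {x} = internal-reflected G Gv x x (simplicial⇒simplicial-completeNbhd G v)
    v-free-in-Gv : ¬ T (isInternal Gv v)
    v-free-in-Gv h = to (internal⇔¬simplicial Gv v) h (completeNbhd-simplicial G v)

iv-deleteVertex<iv : (G : Graph (suc n)) (v : Fin (suc n)) → IsInternal G v → iv (deleteVertex G v) < iv G
iv-deleteVertex<iv G v v-internal = begin-strict
  iv G∖v                                 ≡⟨ iv≡∣internal∣ G∖v ⟩
  ∣ internal G∖v ∣                       ≤⟨ p⊆q⇒∣p∣≤∣q∣ internalG∖v⊆internalG ⟩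
  ∣ tabulate (isInternal G ∘ punchIn v) ∣ ≡⟨ cong ∣_∣ (removeAt-tabulate (isInternal G) v) ⟨
  ∣ removeAt (internal G) v ∣            <⟨ ∣removeAt∣<∣p∣ (internal G) v v∈internalG ⟩
  ∣ internal G ∣                         ≡⟨ iv≡∣internal∣ G ⟨
  iv G                                   ∎
  where
    open ≤-Reasoning
    G∖v = deleteVertex G v
    internalG∖v⊆internalG : internal G∖v ⊆ tabulate (isInternal G ∘ punchIn v)
    internalG∖v⊆internalG = tabulate-⊆ λ {i} →
      internal-reflected G G∖v (punchIn v i) i (simplicial⇒simplicial-deleteVertex G v)
    v∈internalG : T (lookup (internal G) v)
    v∈internalG = ⊆ᶠ-lookup∘tabulate (isInternal G) (from T-not-≡ v-internal)

lemma3p2 : ∀ {m : ℕ} (G : Graph (suc m)) (v : Fin (suc m)) →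
    IsInternal G v →
    (iv G > iv (completeNbhd G v)) × (iv G > iv (deleteVertex G v))
lemma3p2 G v v-internal = iv-completeNbhd<iv G v v-internal , iv-deleteVertex<iv G v v-internal
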